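{- Let $\mathbb A$ be a coherent algebra of matrices indexed by a finite set $X$. Consider the following four rooted diagrams, each with root list $(r_1,r_2,r_3)$: $\Delta$: nodes $r_1,r_2,r_3$ and edges $r_1r_2,r_2r_3,r_3r_1$; $Y$: nodes $r_1,r_2,r_3,c$ and edges $cr_1,cr_2,cr_3$; $N$: nodes $r_1,r_2,r_3,t_1,t_2,t_3$ and edges $t_1t_2,t_2t_3,t_3t_1,r_1t_1,r_2t_2,r_3t_3$; $K$: nodes $r_1,r_2,r_3,c$ and edges $r_1r_2,r_2r_3,r_3r_1,cr_1,cr_2,cr_3$. Then $\mathbf W(\Delta;\mathbb A)$ and $\mathbf W(Y;\mathbb A)$ are both contained in $\mathbf W(N;\mathbb A)$ and in $\mathbf W(K;\mathbb A)$.
   Context: A coherent algebra is a complex vector space $\mathbb A$ of matrices with rows and columns indexed by $X$, closed under ordinary product, entrywise product, transpose and entrywise conjugation, containing $I$ and the all-ones matrix $J$. For a finite graph $G$ and list $R=(r_1,\dots,r_m)$ of distinct nodes, $\mathbf W((G,R);\mathbb A)$ is the span of all third-order (here $m=3$) tensors $\mathsf S(G,R;w)=\sum_{\varphi:V(G)\to X}\big(\prod_{e=(a,b)\in E(G)}w(e)_{\varphi(a),\varphi(b)}\big)\widehat{\varphi(r_1)}\otimes\cdots\otimes\widehat{\varphi(r_m)}$ with $w:E(G)\to\mathbb A$, edges oriented arbitrarily (the span is independent of orientation since $\mathbb A$ is transpose-closed); $\{\hat x\}$ is the standard basis of $\mathbb C^X$. Non-root nodes are summed over. -}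

module Defs where

open import Level using (Level; _⊔_)
open import Data.Nat using (ℕ; zero; suc)
open import Data.Fin using (Fin; zero; suc; _≟_)
open import Data.Product using (Σ; _×_; _,_; ∃)
open import Data.Bool using (if_then_else_)
open import Relation.Nullary.Decidable using (⌊_⌋)
open import Relation.Binary.PropositionalEquality using (_≡_; refl)
open import Function.Definitions using (Injective)
open import Algebra.Bundles using (CommutativeRing)

-- Scalars: an arbitrary commutative ring R with an involution "conj"
-- (standing in for ℂ with complex conjugation, which stdlib lacks).
-- X is Fin n.

module _ {c ℓ} (R : CommutativeRing c ℓ) where
  open CommutativeRing R using (Carrier; _≈_; _+_; _*_; 0#; 1#)

  sumF : (m : ℕ) → (Fin m → Carrier) → Carrier
  sumF zero    f = 0#
  sumF (suc m) f = f zero + sumF m (λ i → f (suc i))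

  prodF : (m : ℕ) → (Fin m → Carrier) → Carrier
  prodF zero    f = 1#
  prodF (suc m) f = f zero * prodF m (λ i → f (suc i))

  consF : ∀ {k n} → Fin n → (Fin k → Fin n) → Fin (suc k) → Fin n
  consF x φ zero    = x
  consF x φ (suc i) = φ i

  sumMaps : (k n : ℕ) → ((Fin k → Fin n) → Carrier) → Carrier
  sumMaps zero    n f = f (λ ())
  sumMaps (suc k) n f = sumF n (λ x → sumMaps k n (λ φ → f (consF x φ)))

  δ : ∀ {n} → Fin n → Fin n → Carrier
  δ x y = if ⌊ x ≟ y ⌋ then 1# else 0#

  Matrix : ℕ → Set c
  Matrix n = Fin n → Fin n → Carrier

  _≈M_ : ∀ {n} → Matrix n → Matrix n → Set ℓ
  M ≈M N = ∀ x y → M x y ≈ N x y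

  _+M_ : ∀ {n} → Matrix n → Matrix n → Matrix n
  (M +M N) x y = M x y + N x y

  _·M_ : ∀ {n} → Carrier → Matrix n → Matrix n
  (a ·M M) x y = a * M x y

  _⊗M_ : ∀ {n} → Matrix n → Matrix n → Matrix n
  _⊗M_ {n} M N x y = sumF n (λ z → M x z * N z y)

  _∘M_ : ∀ {n} → Matrix n → Matrix n → Matrix n
  (M ∘M N) x y = M x y * N x y

  transposeM : ∀ {n} → Matrix n → Matrix n
  transposeM M x y = M y x

  Iₘ : ∀ {n} → Matrix n
  Iₘ x y = δ x y

  Jₘ : ∀ {n} → Matrix n
  Jₘ x y = 1#

  record Conjugation : Set (c ⊔ ℓ) where
    field
      conj       : Carrier → Carrier
      conj-cong  : ∀ {a b} → a ≈ b → conj a ≈ conj b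
      conj-+     : ∀ a b → conj (a + b) ≈ conj a + conj b
      conj-*     : ∀ a b → conj (a * b) ≈ conj a * conj b
      conj-1     : conj 1# ≈ 1#
      conj-invol : ∀ a → conj (conj a) ≈ a

  record IsCoherentAlgebra {p} (σ : Conjugation) (n : ℕ)
                           (𝔸 : Matrix n → Set p) : Set (c ⊔ ℓ ⊔ p) where
    open Conjugation σ
    field
      resp        : ∀ {M N} → M ≈M N → 𝔸 M → 𝔸 N
      +-closed    : ∀ {M N} → 𝔸 M → 𝔸 N → 𝔸 (M +M N)
      ·-closed    : ∀ a {M} → 𝔸 M → 𝔸 (a ·M M)
      ⊗-closed    : ∀ {M N} → 𝔸 M → 𝔸 N → 𝔸 (M ⊗M N)
      ∘-closed    : ∀ {M N} → 𝔸 M → 𝔸 N → 𝔸 (M ∘M N)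
      T-closed    : ∀ {M} → 𝔸 M → 𝔸 (transposeM M)
      conj-closed : ∀ {M} → 𝔸 M → 𝔸 (λ x y → conj (M x y))
      I-mem       : 𝔸 Iₘ
      J-mem       : 𝔸 Jₘ

  Tensor : ℕ → Set c
  Tensor n = Fin n → Fin n → Fin n → Carrier

  _≈T_ : ∀ {n} → Tensor n → Tensor n → Set ℓ
  T ≈T U = ∀ x y z → T x y z ≈ U x y z

  0T : ∀ {n} → Tensor n
  0T x y z = 0#

  _+T_ : ∀ {n} → Tensor n → Tensor n → Tensor n
  (T +T U) x y z = T x y z + U x y z

  _·T_ : ∀ {n} → Carrier → Tensor n → Tensor n
  (a ·T T) x y z = a * T x y z

-- Finite (multi)graphs with a list of 3 distinct roots.
-- Nodes are Fin nodes; each edge is an ordered pair (orientation arbitrary).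

record RootedGraph : Set where
  field
    nodes    : ℕ
    nedges   : ℕ
    edge     : Fin nedges → Fin nodes × Fin nodes
    root     : Fin 3 → Fin nodes
    root-inj : Injective _≡_ _≡_ root

module _ {c ℓ} (R : CommutativeRing c ℓ) where
  open CommutativeRing R using (Carrier; _≈_; _+_; _*_; 0#; 1#)
  open RootedGraph

  Weight : (n : ℕ) → RootedGraph → Set c
  Weight n G = Fin (nedges G) → Matrix R n

  -- The tensor S(G,R;w): entry at (x₁,x₂,x₃) is the sum over all
  -- φ : V(G) → X with φ(rᵢ) = xᵢ of ∏_{e=(a,b)} w(e)_{φ a, φ b}.
  S : (n : ℕ) (G : RootedGraph) → Weight n G → Tensor R n
  S n G w x₁ x₂ x₃ =
    sumMaps R (nodes G) n (λ φ →
        (δ R (φ (root G zero)) x₁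
      * (δ R (φ (root G (suc zero))) x₂
      *  δ R (φ (root G (suc (suc zero)))) x₃))
      * prodF R (nedges G) (λ e →
          let (a , b) = edge G e in w e (φ a) (φ b)))

  data Span {p} (n : ℕ) (𝔸 : Matrix R n → Set p) (G : RootedGraph)
       : Tensor R n → Set (c ⊔ p) where
    span-zero : Span n 𝔸 G (0T R)
    span-step : ∀ {U} (a : Carrier) (w : Weight n G) →
                (∀ e → 𝔸 (w e)) → Span n 𝔸 G U →
                Span n 𝔸 G (_+T_ R (_·T_ R a (S n G w)) U)

  _∈W_ : ∀ {p} {n : ℕ} → Tensor R n →
         (Σ (Matrix R n → Set p) (λ _ → RootedGraph)) → Set (c ⊔ ℓ ⊔ p)
  _∈W_ {n = n} T (𝔸 , G) = Σ (Tensor R n) (λ U → Span n 𝔸 G U × _≈T_ R T U)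

  W⊆ : ∀ {p} (n : ℕ) (𝔸 : Matrix R n → Set p) (G H : RootedGraph) →
       Set (c ⊔ ℓ ⊔ p)
  W⊆ n 𝔸 G H = ∀ T → T ∈W (𝔸 , G) → T ∈W (𝔸 , H)

-- The four diagrams.  Roots r₁,r₂,r₃ are nodes 0,1,2.

private
  f0 f1 f2 : ∀ {k} → Fin (3 Data.Nat.+ k)
  f0 = zero
  f1 = suc zero
  f2 = suc (suc zero)

rootStd : ∀ {k} → Fin 3 → Fin (3 Data.Nat.+ k)
rootStd zero = zero
rootStd (suc zero) = suc zero
rootStd (suc (suc zero)) = suc (suc zero)

rootStd-inj : ∀ {k} → Injective _≡_ _≡_ (rootStd {k})
rootStd-inj {k} {zero} {zero} _ = refl
rootStd-inj {k} {zero} {suc zero} ()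
rootStd-inj {k} {zero} {suc (suc zero)} ()
rootStd-inj {k} {suc zero} {zero} ()
rootStd-inj {k} {suc zero} {suc zero} _ = refl
rootStd-inj {k} {suc zero} {suc (suc zero)} ()
rootStd-inj {k} {suc (suc zero)} {zero} ()
rootStd-inj {k} {suc (suc zero)} {suc zero} ()
rootStd-inj {k} {suc (suc zero)} {suc (suc zero)} _ = refl

Δ-edges : Fin 3 → Fin 3 × Fin 3
Δ-edges zero = (f0 , f1)
Δ-edges (suc zero) = (f1 , f2)
Δ-edges (suc (suc zero)) = (f2 , f0)

Δ : RootedGraph
Δ = record { nodes = 3 ; nedges = 3 ; edge = Δ-edges
           ; root = rootStd ; root-inj = rootStd-inj }

cY : Fin 4
cY = suc (suc (suc zero))

Y-edges : Fin 3 → Fin 4 × Fin 4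
Y-edges zero = (cY , f0)
Y-edges (suc zero) = (cY , f1)
Y-edges (suc (suc zero)) = (cY , f2)

Y : RootedGraph
Y = record { nodes = 4 ; nedges = 3 ; edge = Y-edges
           ; root = rootStd ; root-inj = rootStd-inj }

t1 t2 t3 : Fin 6
t1 = suc (suc (suc zero))
t2 = suc (suc (suc (suc zero)))
t3 = suc (suc (suc (suc (suc zero))))

N-edges : Fin 6 → Fin 6 × Fin 6
N-edges zero = (t1 , t2)
N-edges (suc zero) = (t2 , t3)
N-edges (suc (suc zero)) = (t3 , t1)
N-edges (suc (suc (suc zero))) = (f0 , t1)
N-edges (suc (suc (suc (suc zero)))) = (f1 , t2)
N-edges (suc (suc (suc (suc (suc zero))))) = (f2 , t3)

N : RootedGraph
N = record { nodes = 6 ; nedges = 6 ; edge = N-edges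
           ; root = rootStd ; root-inj = rootStd-inj }

K-edges : Fin 6 → Fin 4 × Fin 4
K-edges zero = (f0 , f1)
K-edges (suc zero) = (f1 , f2)
K-edges (suc (suc zero)) = (f2 , f0)
K-edges (suc (suc (suc zero))) = (cY , f0)
K-edges (suc (suc (suc (suc zero)))) = (cY , f1)
K-edges (suc (suc (suc (suc (suc zero))))) = (cY , f2)

K : RootedGraph
K = record { nodes = 4 ; nedges = 6 ; edge = K-edges
           ; root = rootStd ; root-inj = rootStd-inj }

-- Each generator of W(Δ) and of W(Y) is itself a generator of W(N) and of W(K):
-- put I on the edges whose endpoints should be identified and J on the edges that
-- should disappear.  In N, I on the spokes contracts N to Δ and I on the inner
-- triangle contracts N to Y; in K, J on the spokes (with I on one, so that the
-- centre sum is 1 rather than |X|) leaves Δ, and J on the triangle leaves Y.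
-- Y's edges point from the centre while N's spokes point towards it, hence the
-- transposed weights, which stay in 𝔸 by transpose-closure.
module Submission where

open import Defs
open import Data.Nat as ℕ using (ℕ; zero; suc)
open import Data.Fin using (Fin; zero; suc; splitAt; _≟_)
open import Data.Bool using (if_then_else_)
open import Data.Product using (_×_; _,_; Σ)
open import Data.Sum using (inj₁; inj₂)
open import Data.Vec.Functional using (Vector; []; _∷_; _++_; map; replicate)
open import Data.Vec.Functional.Relation.Unary.All using (All)
open import Relation.Binary.PropositionalEquality as ≡ using (_≡_)
open import Relation.Nullary.Decidable using (⌊⌋-map′)
open import Relation.Unary using (Pred)
open import Algebra.Bundles using (CommutativeRing)
open import Function using (_∘_)
import Algebra.Solver.CommutativeMonoid as CommutativeMonoidSolver
import Relation.Binary.Reasoning.Setoid as SetoidReasoning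

All-++ : ∀ {a p} {A : Set a} (P : Pred A p) {m k} {xs : Vector A m} {ys : Vector A k} →
         All P xs → All P ys → All P (xs ++ ys)
All-++ P {m} pxs pys i with splitAt m i
... | inj₁ j = pxs j
... | inj₂ j = pys j

-- Δ, Y, N and K are all definitionally of this form.
rooted : ∀ {k m} → (Fin m → Fin (3 ℕ.+ k) × Fin (3 ℕ.+ k)) → RootedGraph
rooted E = record { nodes = _ ; nedges = _ ; edge = E ; root = rootStd ; root-inj = rootStd-inj }

module Evaluation {c ℓ} (R : CommutativeRing c ℓ) where
  open CommutativeRing R hiding (zero)
  open SetoidReasoning setoid
  open CommutativeMonoidSolver *-commutativeMonoid using (solve; _⊜_; _⊕_; id)

  sumF-cong : ∀ m {f g : Fin m → Carrier} → (∀ i → f i ≈ g i) → sumF R m f ≈ sumF R m g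
  sumF-cong zero    eq = refl
  sumF-cong (suc m) eq = +-cong (eq zero) (sumF-cong m (λ i → eq (suc i)))

  *-distribˡ-sumF : ∀ m a (f : Fin m → Carrier) → a * sumF R m f ≈ sumF R m (λ i → a * f i)
  *-distribˡ-sumF zero    a f = zeroʳ a
  *-distribˡ-sumF (suc m) a f =
    trans (distribˡ a _ _) (+-congˡ (*-distribˡ-sumF m a (λ i → f (suc i))))

  sumF-zero : ∀ m {f : Fin m → Carrier} → (∀ i → f i ≈ 0#) → sumF R m f ≈ 0#
  sumF-zero zero    eq = refl
  sumF-zero (suc m) eq = trans (+-cong (eq zero) (sumF-zero m (λ i → eq (suc i)))) (+-identityˡ 0#)

  *-distribˡ-sumMaps : ∀ k n a (f : (Fin k → Fin n) → Carrier) →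
                       a * sumMaps R k n f ≈ sumMaps R k n (λ φ → a * f φ)
  *-distribˡ-sumMaps zero    n a f = refl
  *-distribˡ-sumMaps (suc k) n a f =
    trans (*-distribˡ-sumF n a _) (sumF-cong n (λ x → *-distribˡ-sumMaps k n a _))

  δ-suc : ∀ {n} (a b : Fin n) → δ R (suc a) (suc b) ≡ δ R a b
  δ-suc a b = ≡.cong (λ t → if t then 1# else 0#) (⌊⌋-map′ _ _ (a ≟ b))

  δ-refl : ∀ {n} (a : Fin n) → δ R a a ≡ 1#
  δ-refl zero    = ≡.refl
  δ-refl (suc a) = ≡.trans (δ-suc a a) (δ-refl a)

  δ-comm : ∀ {n} (a b : Fin n) → δ R a b ≡ δ R b a
  δ-comm zero    zero    = ≡.refl
  δ-comm zero    (suc b) = ≡.refl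
  δ-comm (suc a) zero    = ≡.refl
  δ-comm (suc a) (suc b) = ≡.trans (δ-suc a b) (≡.trans (δ-comm a b) (≡.sym (δ-suc b a)))

  sumF-δ : ∀ {n} (x : Fin n) (g : Fin n → Carrier) → sumF R n (λ a → δ R a x * g a) ≈ g x
  sumF-δ {suc n} zero g = begin
    1# * g zero + sumF R n (λ i → 0# * g (suc i)) ≈⟨ +-cong (*-identityˡ _) (sumF-zero n (λ i → zeroˡ _)) ⟩
    g zero + 0#                                   ≈⟨ +-identityʳ _ ⟩
    g zero                                        ∎
  sumF-δ {suc n} (suc x) g = begin
    0# * g zero + sumF R n (λ i → δ R (suc i) (suc x) * g (suc i))
      ≈⟨ +-cong (zeroˡ _) (sumF-cong n (λ i → *-congʳ (reflexive (δ-suc i x)))) ⟩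
    0# + sumF R n (λ i → δ R i x * g (suc i))
      ≈⟨ +-identityˡ _ ⟩
    sumF R n (λ i → δ R i x * g (suc i))
      ≈⟨ sumF-δ x (λ i → g (suc i)) ⟩
    g (suc x) ∎

  sumF-sift : ∀ {n} (x : Fin n) {f : Fin n → Carrier} (g : Fin n → Carrier) →
              (∀ a → f a ≈ δ R a x * g a) → sumF R n f ≈ g x
  sumF-sift {n} x g eq = trans (sumF-cong n eq) (sumF-δ x g)

  sumF³-sift : ∀ {n} (x y z : Fin n) {f : Fin n → Fin n → Fin n → Carrier}
               (F : Fin n → Fin n → Fin n → Carrier) →
               (∀ a b c → f a b c ≈ δ R a x * (δ R b y * (δ R c z * F a b c))) →
               sumF R n (λ a → sumF R n (λ b → sumF R n (λ c → f a b c))) ≈ F x y z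
  sumF³-sift x y z F eq =
    sumF-sift x (λ a → F a y z) λ a →
      sumF-sift y (λ b → δ R a x * F a b z) λ b →
        sumF-sift z (λ c → δ R b y * (δ R a x * F a b c)) λ c →
          trans (eq a b c)
            (solve 4 (λ p q r s → p ⊕ (q ⊕ (r ⊕ s)) ⊜ r ⊕ (q ⊕ (p ⊕ s))) refl
               (δ R a x) (δ R b y) (δ R c z) (F a b c))

  module _ {n : ℕ} where

    edgeProduct : ∀ {m v} → (Fin m → Fin v × Fin v) → Vector (Matrix R n) m →
                  (Fin v → Fin n) → Carrier
    edgeProduct {m} E w φ = prodF R m (λ e → let (a , b) = E e in w e (φ a) (φ b))

    S-rooted : ∀ {k m} (E : Fin m → Fin (3 ℕ.+ k) × Fin (3 ℕ.+ k)) w (x y z : Fin n) →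
               S R n (rooted E) w x y z ≈
               sumMaps R k n (λ ψ → edgeProduct E w (consF R x (consF R y (consF R z ψ))))
    S-rooted {k} E w x y z = sumF³-sift x y z placed λ a b c →
      trans (sym (*-distribˡ-sumMaps k n _ _)) (trans (*-assoc _ _ _) (*-congˡ (*-assoc _ _ _)))
      where
      placed : Fin n → Fin n → Fin n → Carrier
      placed a b c = sumMaps R k n (λ ψ → edgeProduct E w (consF R a (consF R b (consF R c ψ))))

    triangle : Vector (Matrix R n) 3 → Fin n → Fin n → Fin n → Carrier
    triangle W a b c = W zero a b * (W (suc zero) b c * W (suc (suc zero)) c a)

    star : Vector (Matrix R n) 3 → Fin n → Fin n → Fin n → Carrier
    star W a b c = sumF R n (λ d → W zero d a * (W (suc zero) d b * W (suc (suc zero)) d c))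

    spokedTriangle : Vector (Matrix R n) 3 → Vector (Matrix R n) 3 →
                     Fin n → Fin n → Fin n → Carrier
    spokedTriangle U V a b c =
      sumF R n λ t₁ → sumF R n λ t₂ → sumF R n λ t₃ →
        V zero a t₁ * (V (suc zero) b t₂ * (V (suc (suc zero)) c t₃ * triangle U t₁ t₂ t₃))

    S-Δ : ∀ W x y z → S R n Δ W x y z ≈ triangle W x y z
    S-Δ W x y z = trans (S-rooted Δ-edges W x y z) (*-congˡ (*-congˡ (*-identityʳ _)))

    S-Y : ∀ W x y z → S R n Y W x y z ≈ star W x y z
    S-Y W x y z =
      trans (S-rooted Y-edges W x y z) (sumF-cong n λ d → *-congˡ (*-congˡ (*-identityʳ _)))

    S-K : ∀ U V x y z → S R n K (U ++ V) x y z ≈ triangle U x y z * star V x y z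
    S-K U V x y z = begin
      S R n K (U ++ V) x y z
        ≈⟨ S-rooted K-edges (U ++ V) x y z ⟩
      sumF R n (λ d → u₀ * (u₁ * (u₂ * (V zero d x * (V (suc zero) d y * (V (suc (suc zero)) d z * 1#))))))
        ≈⟨ sumF-cong n (λ d → solve 6 (λ a b c p q r → a ⊕ (b ⊕ (c ⊕ (p ⊕ (q ⊕ (r ⊕ id))))) ⊜
                                                      (a ⊕ (b ⊕ c)) ⊕ (p ⊕ (q ⊕ r))) refl
                         u₀ u₁ u₂ (V zero d x) (V (suc zero) d y) (V (suc (suc zero)) d z)) ⟩
      sumF R n (λ d → triangle U x y z * (V zero d x * (V (suc zero) d y * V (suc (suc zero)) d z)))
        ≈⟨ sym (*-distribˡ-sumF n _ _) ⟩
      triangle U x y z * star V x y z ∎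
      where
      u₀ u₁ u₂ : Carrier
      u₀ = U zero x y
      u₁ = U (suc zero) y z
      u₂ = U (suc (suc zero)) z x

    S-N : ∀ U V x y z → S R n N (U ++ V) x y z ≈ spokedTriangle U V x y z
    S-N U V x y z = trans (S-rooted N-edges (U ++ V) x y z)
      (sumF-cong n λ t₁ → sumF-cong n λ t₂ → sumF-cong n λ t₃ →
        solve 6 (λ a b c p q r → a ⊕ (b ⊕ (c ⊕ (p ⊕ (q ⊕ (r ⊕ id))))) ⊜ p ⊕ (q ⊕ (r ⊕ (a ⊕ (b ⊕ c)))))
          refl (U zero t₁ t₂) (U (suc zero) t₂ t₃) (U (suc (suc zero)) t₃ t₁)
               (V zero x t₁) (V (suc zero) y t₂) (V (suc (suc zero)) z t₃))

    spokedTriangle-identitySpokes : ∀ U x y z →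
      spokedTriangle U (replicate 3 (Iₘ R)) x y z ≈ triangle U x y z
    spokedTriangle-identitySpokes U x y z = sumF³-sift x y z (triangle U) λ a b c →
      *-cong (reflexive (δ-comm x a))
        (*-cong (reflexive (δ-comm y b)) (*-congʳ (reflexive (δ-comm z c))))

    sumF²-δ-cycle : ∀ t (Q : Fin n → Fin n → Carrier) →
      sumF R n (λ u → sumF R n (λ v → δ R t u * (δ R u v * (δ R v t * Q u v)))) ≈ Q t t
    sumF²-δ-cycle t Q = begin
      sumF R n (λ u → sumF R n (λ v → δ R t u * (δ R u v * (δ R v t * Q u v))))
        ≈⟨ sumF-cong n (λ u → sym (*-distribˡ-sumF n _ _)) ⟩
      sumF R n (λ u → δ R t u * sumF R n (λ v → δ R u v * (δ R v t * Q u v)))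
        ≈⟨ sumF-cong n (λ u → *-congˡ (sumF-sift u (λ v → δ R v t * Q u v)
                                          (λ v → *-congʳ (reflexive (δ-comm u v))))) ⟩
      sumF R n (λ u → δ R t u * (δ R u t * Q u u))
        ≈⟨ sumF-sift t (λ u → δ R u t * Q u u) (λ u → *-congʳ (reflexive (δ-comm t u))) ⟩
      δ R t t * Q t t
        ≈⟨ trans (*-congʳ (reflexive (δ-refl t))) (*-identityˡ _) ⟩
      Q t t ∎

    spokedTriangle-identityTriangle : ∀ W x y z →
      spokedTriangle (replicate 3 (Iₘ R)) (map (transposeM R) W) x y z ≈ star W x y z
    spokedTriangle-identityTriangle W x y z = sumF-cong n λ t →
      trans (sumF-cong n λ u → sumF-cong n λ v →
               solve 6 (λ a b c p q r → a ⊕ (b ⊕ (c ⊕ (p ⊕ (q ⊕ r)))) ⊜ p ⊕ (q ⊕ (r ⊕ (a ⊕ (b ⊕ c)))))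
                 refl (W zero t x) (W (suc zero) u y) (W (suc (suc zero)) v z)
                      (δ R t u) (δ R u v) (δ R v t))
            (sumF²-δ-cycle t (λ u v → W zero t x * (W (suc zero) u y * W (suc (suc zero)) v z)))

    triangle-ones : ∀ x y z → triangle (replicate 3 (Jₘ R)) x y z ≈ 1#
    triangle-ones x y z = trans (*-identityˡ _) (*-identityˡ _)

    star-IJJ : ∀ x y z → star (Iₘ R ∷ Jₘ R ∷ Jₘ R ∷ []) x y z ≈ 1#
    star-IJJ x y z = trans (sumF-δ x (λ _ → 1# * 1#)) (*-identityˡ _)

    S-Δ≈S-N : ∀ W → _≈T_ R (S R n Δ W) (S R n N (W ++ replicate 3 (Iₘ R)))
    S-Δ≈S-N W x y z = begin
      S R n Δ W x y z                                      ≈⟨ S-Δ W x y z ⟩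
      triangle W x y z                                     ≈˘⟨ spokedTriangle-identitySpokes W x y z ⟩
      spokedTriangle W (replicate 3 (Iₘ R)) x y z          ≈˘⟨ S-N W (replicate 3 (Iₘ R)) x y z ⟩
      S R n N (W ++ replicate 3 (Iₘ R)) x y z              ∎

    S-Δ≈S-K : ∀ W → _≈T_ R (S R n Δ W) (S R n K (W ++ (Iₘ R ∷ Jₘ R ∷ Jₘ R ∷ [])))
    S-Δ≈S-K W x y z = begin
      S R n Δ W x y z                                      ≈⟨ S-Δ W x y z ⟩
      triangle W x y z                                     ≈˘⟨ *-identityʳ _ ⟩
      triangle W x y z * 1#                                ≈˘⟨ *-congˡ (star-IJJ x y z) ⟩
      triangle W x y z * star (Iₘ R ∷ Jₘ R ∷ Jₘ R ∷ []) x y z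
        ≈˘⟨ S-K W (Iₘ R ∷ Jₘ R ∷ Jₘ R ∷ []) x y z ⟩
      S R n K (W ++ (Iₘ R ∷ Jₘ R ∷ Jₘ R ∷ [])) x y z ∎

    S-Y≈S-N : ∀ W → _≈T_ R (S R n Y W) (S R n N (replicate 3 (Iₘ R) ++ map (transposeM R) W))
    S-Y≈S-N W x y z = begin
      S R n Y W x y z                                      ≈⟨ S-Y W x y z ⟩
      star W x y z                                         ≈˘⟨ spokedTriangle-identityTriangle W x y z ⟩
      spokedTriangle (replicate 3 (Iₘ R)) (map (transposeM R) W) x y z
        ≈˘⟨ S-N (replicate 3 (Iₘ R)) (map (transposeM R) W) x y z ⟩
      S R n N (replicate 3 (Iₘ R) ++ map (transposeM R) W) x y z ∎

    S-Y≈S-K : ∀ W → _≈T_ R (S R n Y W) (S R n K (replicate 3 (Jₘ R) ++ W))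
    S-Y≈S-K W x y z = begin
      S R n Y W x y z                                      ≈⟨ S-Y W x y z ⟩
      star W x y z                                         ≈˘⟨ *-identityˡ _ ⟩
      1# * star W x y z                                    ≈˘⟨ *-congʳ (triangle-ones x y z) ⟩
      triangle (replicate 3 (Jₘ R)) x y z * star W x y z   ≈˘⟨ S-K (replicate 3 (Jₘ R)) W x y z ⟩
      S R n K (replicate 3 (Jₘ R) ++ W) x y z              ∎

module _ {c ℓ p} (R : CommutativeRing c ℓ) {n : ℕ} {𝔸 : Matrix R n → Set p} {G H : RootedGraph} where
  open CommutativeRing R using (refl; trans; +-cong; *-congˡ)

  W⊆-fromGenerators : (f : Weight R n G → Weight R n H) →
                      (∀ w → All 𝔸 w → All 𝔸 (f w)) →
                      (∀ w → _≈T_ R (S R n G w) (S R n H (f w))) →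
                      W⊆ R n 𝔸 G H
  W⊆-fromGenerators f f-𝔸 S≈S T (U , U∈ , T≈U) with transport U∈
    where
    transport : ∀ {U} → Span R n 𝔸 G U → Σ (Tensor R n) (λ U′ → Span R n 𝔸 H U′ × _≈T_ R U U′)
    transport span-zero = 0T R , span-zero , (λ _ _ _ → refl)
    transport (span-step a w w∈ U∈) with transport U∈
    ... | U′ , U′∈ , U≈U′ = _ , span-step a (f w) (f-𝔸 w w∈) U′∈ ,
                            (λ x y z → +-cong (*-congˡ (S≈S w x y z)) (U≈U′ x y z))
  ... | U′ , U′∈ , U≈U′ = U′ , U′∈ , (λ x y z → trans (T≈U x y z) (U≈U′ x y z))

corollary4p7 : ∀ {c ℓ p} (R : CommutativeRing c ℓ) (σ : Conjugation R)
                 (n : ℕ) (𝔸 : Matrix R n → Set p) →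
                 IsCoherentAlgebra R σ n 𝔸 →
                 (W⊆ R n 𝔸 Δ N × W⊆ R n 𝔸 Δ K) ×
                 (W⊆ R n 𝔸 Y N × W⊆ R n 𝔸 Y K)
corollary4p7 R σ n 𝔸 coherent =
  ( W⊆-fromGenerators R (_++ replicate 3 (Iₘ R)) (λ W W∈ → All-++ 𝔸 W∈ (λ _ → I-mem)) S-Δ≈S-N
  , W⊆-fromGenerators R (_++ (Iₘ R ∷ Jₘ R ∷ Jₘ R ∷ [])) (λ W W∈ → All-++ 𝔸 W∈ I∷J∷J∈) S-Δ≈S-K )
  , ( W⊆-fromGenerators R ((replicate 3 (Iₘ R) ++_) ∘ map (transposeM R))
        (λ W W∈ → All-++ 𝔸 {xs = replicate 3 (Iₘ R)} (λ _ → I-mem) (λ i → T-closed (W∈ i)))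
        S-Y≈S-N
    , W⊆-fromGenerators R (replicate 3 (Jₘ R) ++_)
        (λ W W∈ → All-++ 𝔸 {xs = replicate 3 (Jₘ R)} (λ _ → J-mem) W∈)
        S-Y≈S-K )
  where
  open Evaluation R
  open IsCoherentAlgebra coherent
  I∷J∷J∈ : All 𝔸 (Iₘ R ∷ Jₘ R ∷ Jₘ R ∷ [])
  I∷J∷J∈ zero             = I-mem
  I∷J∷J∈ (suc zero)       = J-mem
  I∷J∷J∈ (suc (suc zero)) = J-mem
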